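{- Let $w\in\Sigma^n$, let $k\ge1$ and let $0\le i_1<i_2<\cdots<i_k\le n-1$ be positions, and let $w'$ be obtained from $w$ by replacing $w[i_\ell]$ with the fresh symbol $\#_\ell$ for each $\ell$. Let $P_j$ be a phrase of the LZ77 factorization of $w$ with first position $l_j$ and last position $r_j$, and let $n_j = |\{\ell : l_j\le i_\ell\le r_j\}|$ be the number of substituted positions in $[l_j,r_j]$. Let $Q_1,\dots,Q_{z'}$ be the phrases of the LZ77 factorization of $w'$, with first positions $l(Q_i)$. Then \[ \bigl|\{ i : l_j \le l(Q_i)\le r_j\}\bigr| \le 3 + \|g_{l_j}\| - \|g_{r_j}\| + 3 n_j. \]
   Context: Positions are $0$-indexed: $w = w[0]w[1]\cdots w[n-1]$ and $w[a:b] = w[a]\cdots w[b]$ (the empty word if $b<a$); $u\sqsubseteq v$ means $u$ is a contiguous substring of $v$. $\Sigma$ is a finite alphabet and $\#_1,\dots,\#_k$ are distinct symbols not in $\Sigma$. The LZ77 factorization of a word $x$ is computed greedily from left to right: if $x[0:m-1]$ has been parsed, the next phrase is the shortest non-empty prefix of the remaining suffix that does not occur as a substring of $x[0:m-1]$; if there is none, the next phrase is the whole remaining suffix. Jump map: set $i_0=-1$. For each $t\in\{0,1,\dots,n\}$ define $g_t:\{0,\dots,k\}\to\{0,\dots,k\}$ by $g_t(k)=k$ and, for $0\le \ell<k$: $g_t(\ell)=\ell+1$ if $w[i_\ell+1:i_{\ell+1}-1]\not\sqsubseteq w'[0:t-1]$, and otherwise $g_t(\ell)=\max\{\ell'>\ell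 : \ell'\le k,\ w[i_\ell+1:i_{\ell'}-1]\sqsubseteq w'[0:t-1]\}$. The jump-depth is $\|g_t\| = \min\{s : g_t^{(s)}(0)\ge k\}$, where $g_t^{(s)}$ is the $s$-fold iterate. -}

module Defs where

open import Data.Nat using (ℕ; zero; suc; _+_; _∸_; _≤_; _<_; _≤?_; _<?_)
open import Data.Fin using (Fin; fromℕ<)
import Data.Fin.Properties as FinP
open import Data.Sum using (_⊎_; inj₁; inj₂)
import Data.Sum.Properties as SumP
open import Data.Product using (_×_; _,_)
open import Data.Bool using (Bool; true; false)
open import Data.List using (List; []; _∷_; _++_; take; drop; length; map; filter)
open import Data.List.Relation.Binary.Infix.Heterogeneous using (Infix)
open import Data.List.Relation.Binary.Infix.Heterogeneous.Properties using (infix?)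
open import Relation.Nullary using (¬_; Dec; yes; no; does)
open import Relation.Nullary.Decidable using (_×-dec_)
open import Relation.Binary.PropositionalEquality using (_≡_)
open import Relation.Binary.Definitions using (DecidableEquality)

_⊑_ : ∀ {A : Set} → List A → List A → Set
u ⊑ v = Infix _≡_ u v

-- LZ77 factorization (relational, greedy, non-self-referential)
--
-- `Phrase pre p rest` : having parsed `pre`, with remaining suffix
-- `p ++ rest`, the next phrase is `p`: p is non-empty, every proper
-- non-empty prefix of p occurs in pre, and either p itself does not occur
-- in pre (p is the shortest non-empty prefix not occurring in pre), or
-- p is the whole remaining suffix (no such prefix exists).

record Phrase {A : Set} (pre p rest : List A) : Set where
  field
    nonEmpty      : 1 ≤ length p
    shorterOccur  : ∀ m → 1 ≤ m → m < length p → take m p ⊑ pre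
    newOrLast     : (¬ (p ⊑ pre)) ⊎ (rest ≡ [])

data LZ77From {A : Set} (pre : List A) : List A → List (List A) → Set where
  done : LZ77From pre [] []
  step : ∀ {p rest ps} → Phrase pre p rest → LZ77From (pre ++ p) rest ps →
         LZ77From pre (p ++ rest) (p ∷ ps)

IsLZ77 : ∀ {A : Set} → List A → List (List A) → Set
IsLZ77 x ps = LZ77From [] x ps

starts : ∀ {A : Set} → ℕ → List (List A) → List ℕ
starts o []       = []
starts o (p ∷ ps) = o ∷ starts (o + length p) ps

spans : ∀ {A : Set} → ℕ → List (List A) → List (ℕ × ℕ)
spans o []       = []
spans o (p ∷ ps) = (o , o + length p ∸ 1) ∷ spans (o + length p) ps

countIn : ℕ → ℕ → List ℕ → ℕ
countIn l r xs = length (filter (λ x → (l ≤? x) ×-dec (x ≤? r)) xs)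

-- Substituted word w' : position pos ℓ gets the fresh symbol inj₂ ℓ
-- (pos ℓ = i_{ℓ+1}, inj₂ ℓ = #_{ℓ+1}); other positions keep inj₁ w[p].

mark : ∀ {A : Set} {k} → (Fin k → ℕ) → ℕ → A → A ⊎ Fin k
mark pos o a with FinP.any? (λ ℓ → pos ℓ Data.Nat.≟ o)
... | yes (ℓ , _) = inj₂ ℓ
... | no _        = inj₁ a

substFrom : ∀ {A : Set} {k} → (Fin k → ℕ) → ℕ → List A → List (A ⊎ Fin k)
substFrom pos o []       = []
substFrom pos o (a ∷ as) = mark pos o a ∷ substFrom pos (suc o) as

replace : ∀ {A : Set} {k} → (Fin k → ℕ) → List A → List (A ⊎ Fin k)
replace pos w = substFrom pos 0 w

-- Jump map and jump-depth, for w over Fin σ and substituted positions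
-- pos : Fin k → ℕ  (pos ℓ = i_{ℓ+1}; i_0 = -1 by convention).

module Jump {σ k : ℕ} (w : List (Fin σ)) (pos : Fin k → ℕ) where

  w' : List (Fin σ ⊎ Fin k)
  w' = replace pos w

  -- i⁺ ℓ = i_ℓ + 1   for 0 ≤ ℓ ≤ k   (i⁺ 0 = 0 since i_0 = -1)
  i⁺ : ℕ → ℕ
  i⁺ zero    = 0
  i⁺ (suc m) with m <? k
  ... | yes m<k = suc (pos (fromℕ< m<k))
  ... | no _    = 0   -- unused (outside 0..k)

  -- seg ℓ ℓ' = w[i_ℓ + 1 : i_ℓ' - 1]   (for 0 ≤ ℓ < ℓ' ≤ k)
  seg : ℕ → ℕ → List (Fin σ)
  seg ℓ ℓ' = take ((i⁺ ℓ' ∸ 1) ∸ i⁺ ℓ) (drop (i⁺ ℓ) w)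

  occ? : (t ℓ ℓ' : ℕ) → Dec (map inj₁ (seg ℓ ℓ') ⊑ take t w')
  occ? t ℓ ℓ' = infix? (SumP.≡-dec FinP._≟_ FinP._≟_) (map inj₁ (seg ℓ ℓ')) (take t w')

  -- best t ℓ c = max { ℓ' : ℓ < ℓ' ≤ c , seg ℓ ℓ' ⊑ w'[0:t-1] }, or ℓ+1 if empty
  best : ℕ → ℕ → ℕ → ℕ
  best t ℓ zero    = suc ℓ
  best t ℓ (suc c) with (ℓ <? suc c) ×-dec occ? t ℓ (suc c)
  ... | yes _ = suc c
  ... | no _  = best t ℓ c

  g : ℕ → ℕ → ℕ
  g t ℓ with k ≤? ℓ
  ... | yes _ = k
  ... | no _ with occ? t ℓ (suc ℓ)
  ...   | no _  = suc ℓ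
  ...   | yes _ = best t ℓ k

  iter : (ℕ → ℕ) → ℕ → ℕ → ℕ
  iter f zero    x = x
  iter f (suc s) x = f (iter f s x)

  -- least s ∈ {b, b+1, …, b+fuel} with P s (returns b+fuel if none)
  leastFrom : (ℕ → Bool) → ℕ → ℕ → ℕ
  leastFrom P b zero = b
  leastFrom P b (suc fuel) with P b
  ... | true  = b
  ... | false = leastFrom P (suc b) fuel

  -- ‖g_t‖ = min { s : g_t^(s)(0) ≥ k }   (always attained with s ≤ k,
  -- since g_t(ℓ) > ℓ for ℓ < k)
  depth : ℕ → ℕ
  depth t = leastFrom (λ s → does (k ≤? iter (g t) s 0)) 0 k

{-# OPTIONS --safe #-}

-- Write the phrase as w[l .. l + L], so that w[l .. l + L - 1] already occurs δ positions
-- earlier, and call i_a (a = g_l^j(0), 0 < j ≤ ‖g_l‖) the chain points of g_l.  The chain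
-- points cut w[0 .. l - 1] into blocks that occur in w'[0 .. l - 1], so a phrase of w' that
-- starts and ends inside [l, r) and is new must contain a substituted position or a chain
-- point moved by δ.  Consecutive phrases of the second kind form an unsubstituted stretch
-- of w'[0 .. r - 1] which contains the moved copy of the block between their first and last
-- chain points, so a single step of g_r jumps over the whole run.  Hence g_r needs one step
-- less than g_l for every such phrase except the first of each run; runs are separated by
-- substituted positions, and charging 3 per substituted position pays for everything else.
module Submission where

open import Defs
open import Data.Nat using (ℕ; zero; suc; _+_; _*_; _∸_; _⊓_; _≤_; _<_; z≤n; s≤s; _≤?_; _<?_)
open import Data.Nat.Properties
open import Data.Fin using (Fin; toℕ; fromℕ<)
import Data.Fin
import Data.Fin.Properties as Fin
open import Data.Sum using (_⊎_; inj₁; inj₂)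
import Data.Sum
open import Data.Product using (_×_; _,_; proj₁; proj₂; ∃-syntax)
open import Data.List using (List; []; _∷_; _++_; take; drop; length; map; filter; tabulate)
open import Data.List.Properties
  using (length-++; ++-assoc; take-take; drop-drop; take-drop; take++drop≡id; ++-identityʳ;
         length-take; filter-accept; filter-reject)
open import Data.List.Membership.Propositional using (_∈_)
open import Data.List.Membership.Propositional.Properties using (∈-tabulate⁺)
open import Data.List.Relation.Unary.Any using (here; there)
open import Data.List.Relation.Binary.Infix.Heterogeneous using (here; there; _++ⁱ_; _ⁱ++_; toView; MkView)
import Data.List.Relation.Binary.Infix.Heterogeneous as InfixH
import Data.List.Relation.Binary.Infix.Heterogeneous.Properties as Infix
import Data.List.Relation.Binary.Pointwise as Pointwise
import Data.List.Relation.Binary.Prefix.Heterogeneous as Prefix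
open import Relation.Binary.PropositionalEquality
open import Relation.Nullary using (¬_; yes; no; does)
open import Relation.Nullary.Decidable using (_×-dec_)
open import Relation.Nullary.Negation using (contradiction)
open import Algebra.Properties.CommutativeSemigroup +-commutativeSemigroup renaming (xy∙z≈xz∙y to +-right-comm)
open import Relation.Unary using (Pred; Decidable)
open import Level using (0ℓ)

module _ {A : Set} where

  slice : List A → ℕ → ℕ → List A
  slice v a m = take m (drop a v)

  take-length-++ : ∀ (pre v : List A) → take (length pre) (pre ++ v) ≡ pre
  take-length-++ []        v = refl
  take-length-++ (x ∷ pre) v = cong (x ∷_) (take-length-++ pre v)

  drop-length-++ : ∀ (pre v : List A) → drop (length pre) (pre ++ v) ≡ v
  drop-length-++ []        v = refl
  drop-length-++ (x ∷ pre) v = drop-length-++ pre v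

  slice-++ : ∀ (pre u suf : List A) → slice (pre ++ u ++ suf) (length pre) (length u) ≡ u
  slice-++ pre u suf = begin
    take (length u) (drop (length pre) (pre ++ u ++ suf)) ≡⟨ cong (take (length u)) (drop-length-++ pre _) ⟩
    take (length u) (u ++ suf)                             ≡⟨ take-length-++ u suf ⟩
    u                                                      ∎
    where open ≡-Reasoning

  slice-slice : ∀ (v : List A) a d m M → d + m ≤ M → slice (slice v a M) d m ≡ slice v (a + d) m
  slice-slice v a d m M d+m≤M = begin
    take m (drop d (take M (drop a v)))              ≡⟨ cong (λ n → take m (drop d (take n (drop a v)))) M≡d+[M∸d] ⟩
    take m (drop d (take (d + (M ∸ d)) (drop a v)))  ≡⟨ cong (take m) (take-drop (M ∸ d) d (drop a v)) ⟨
    take m (take (M ∸ d) (drop d (drop a v)))        ≡⟨ take-take m (M ∸ d) _ ⟩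
    take (m ⊓ (M ∸ d)) (drop d (drop a v))           ≡⟨ cong₂ take (m≤n⇒m⊓n≡m m≤M∸d) (drop-drop a d v) ⟩
    take m (drop (a + d) v)                          ∎
    where
    open ≡-Reasoning
    M≡d+[M∸d] : M ≡ d + (M ∸ d)
    M≡d+[M∸d] = sym (m+[n∸m]≡n (≤-trans (m≤m+n d m) d+m≤M))
    m≤M∸d : m ≤ M ∸ d
    m≤M∸d = subst (_≤ M ∸ d) (m+n∸m≡n d m) (∸-monoˡ-≤ d d+m≤M)

  length-slice : ∀ (v : List A) a m → length (slice v a m) ≤ m
  length-slice v a m = subst (_≤ m) (sym (length-take m (drop a v))) (m⊓n≤m m _)

  ⊑-refl : ∀ {u : List A} → u ⊑ u
  ⊑-refl = Infix.fromPointwise (Pointwise.refl refl)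

  ⊑-trans : ∀ {u v x : List A} → u ⊑ v → v ⊑ x → u ⊑ x
  ⊑-trans = Infix.trans trans

  ⊑-++ : ∀ (pre u suf : List A) → u ⊑ (pre ++ u ++ suf)
  ⊑-++ pre u suf = pre ++ⁱ (⊑-refl ⁱ++ suf)

  slice-⊑ : ∀ (v : List A) a m → slice v a m ⊑ v
  slice-⊑ v a m = subst (slice v a m ⊑_) v≡ (⊑-++ (take a v) (slice v a m) (drop m (drop a v)))
    where
    v≡ : take a v ++ slice v a m ++ drop m (drop a v) ≡ v
    v≡ = trans (cong (take a v ++_) (take++drop≡id m (drop a v))) (take++drop≡id a v)

  slice-⊑-take : ∀ (v : List A) a m t → a + m ≤ t → slice v a m ⊑ take t v
  slice-⊑-take v a m t a+m≤t = subst (_⊑ take t v) (slice-slice v 0 a m t a+m≤t) (slice-⊑ (take t v) a m)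

  take-⊑-take : ∀ (v : List A) {t t'} → t ≤ t' → take t v ⊑ take t' v
  take-⊑-take v {t} {t'} = slice-⊑-take v 0 t t'

  ⊑⇒slice : ∀ {u v : List A} → u ⊑ v → ∃[ j ] j + length u ≤ length v × slice v j (length u) ≡ u
  ⊑⇒slice u⊑v with MkView pre {inf} u≋inf suf ← toView u⊑v with refl ← Pointwise.Pointwise-≡⇒≡ u≋inf =
    length pre , length-bound , slice-++ pre inf suf
    where
    length-bound : length pre + length inf ≤ length (pre ++ inf ++ suf)
    length-bound = subst (length pre + length inf ≤_) (sym (trans (length-++ pre) (cong (length pre +_) (length-++ inf))))
                         (+-monoʳ-≤ (length pre) (m≤m+n (length inf) (length suf)))

⊑-map : ∀ {A B : Set} (f : A → B) {u v : List A} → u ⊑ v → map f u ⊑ map f v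
⊑-map f u⊑v = Infix.map⁺ f f (InfixH.map (cong f) u⊑v)

module _ {k : ℕ} (pos : Fin k → ℕ) where

  Unmarked : ℕ → ℕ → Set
  Unmarked a b = ∀ ℓ → pos ℓ < a ⊎ b ≤ pos ℓ

  Unmarked-⊆ : ∀ {a b a' b'} → a ≤ a' → b' ≤ b → Unmarked a b → Unmarked a' b'
  Unmarked-⊆ a≤a' b'≤b unmarked ℓ = Data.Sum.map (λ p<a → <-≤-trans p<a a≤a') (≤-trans b'≤b) (unmarked ℓ)

  Unmarked-join : ∀ {a b c} → Unmarked a b → Unmarked b c → Unmarked a c
  Unmarked-join ab bc ℓ with ab ℓ | bc ℓ
  ... | inj₁ p<a | _        = inj₁ p<a
  ... | inj₂ _   | inj₂ c≤p = inj₂ c≤p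
  ... | inj₂ b≤p | inj₁ p<b = contradiction b≤p (<⇒≱ p<b)

  unmarked-or-marked : ∀ a b → Unmarked a b ⊎ ∃[ ℓ ] a ≤ pos ℓ × pos ℓ < b
  unmarked-or-marked a b with Fin.any? (λ ℓ → (a ≤? pos ℓ) ×-dec (pos ℓ <? b))
  ... | yes marked = inj₂ marked
  ... | no ¬marked = inj₁ unmarked
    where
    unmarked : Unmarked a b
    unmarked ℓ with a ≤? pos ℓ | pos ℓ <? b
    ... | no a≰p  | _       = inj₁ (≰⇒> a≰p)
    ... | yes _   | no p≮b  = inj₂ (≮⇒≥ p≮b)
    ... | yes a≤p | yes p<b = contradiction (ℓ , a≤p , p<b) ¬marked

  module _ {A : Set} where

    length-substFrom : ∀ o (v : List A) → length (substFrom pos o v) ≡ length v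
    length-substFrom o []      = refl
    length-substFrom o (a ∷ v) = cong suc (length-substFrom (suc o) v)

    drop-substFrom : ∀ d o (v : List A) → drop d (substFrom pos o v) ≡ substFrom pos (o + d) (drop d v)
    drop-substFrom zero    o v       = cong (λ o' → substFrom pos o' v) (sym (+-identityʳ o))
    drop-substFrom (suc d) o []      = refl
    drop-substFrom (suc d) o (a ∷ v) =
      trans (drop-substFrom d (suc o) v) (cong (λ o' → substFrom pos o' (drop d v)) (sym (+-suc o d)))

    take-substFrom : ∀ m o (v : List A) → take m (substFrom pos o v) ≡ substFrom pos o (take m v)
    take-substFrom zero    o v       = refl
    take-substFrom (suc m) o []      = refl
    take-substFrom (suc m) o (a ∷ v) = cong (_ ∷_) (take-substFrom m (suc o) v)

    mark-unmarked : ∀ o (a : A) → Unmarked o (suc o) → mark pos o a ≡ inj₁ a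
    mark-unmarked o a unmarked with Fin.any? (λ ℓ → pos ℓ Data.Nat.≟ o)
    ... | no _ = refl
    ... | yes (ℓ , refl) with unmarked ℓ
    ...   | inj₁ p<p  = contradiction p<p (<-irrefl refl)
    ...   | inj₂ p<p  = contradiction p<p (<-irrefl refl)

    substFrom-unmarked : ∀ o (v : List A) → Unmarked o (o + length v) → substFrom pos o v ≡ map inj₁ v
    substFrom-unmarked o []      _        = refl
    substFrom-unmarked o (a ∷ v) unmarked = cong₂ _∷_
      (mark-unmarked o a (Unmarked-⊆ ≤-refl (s≤s (m≤m+n o _)) unmarked′))
      (substFrom-unmarked (suc o) v (Unmarked-⊆ (n≤1+n o) ≤-refl unmarked′))
      where
      unmarked′ : Unmarked o (suc (o + length v))
      unmarked′ = subst (Unmarked o) (+-suc o (length v)) unmarked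

    replace-slice-unmarked : ∀ (w : List A) a m → Unmarked a (a + m) →
                             slice (replace pos w) a m ≡ map inj₁ (slice w a m)
    replace-slice-unmarked w a m unmarked = begin
      take m (drop a (substFrom pos 0 w))  ≡⟨ cong (take m) (drop-substFrom a 0 w) ⟩
      take m (substFrom pos a (drop a w))  ≡⟨ take-substFrom m a (drop a w) ⟩
      substFrom pos a (slice w a m)        ≡⟨ substFrom-unmarked a _ (Unmarked-⊆ ≤-refl (+-monoʳ-≤ a (length-slice w a m)) unmarked) ⟩
      map inj₁ (slice w a m)               ∎
      where open ≡-Reasoning

    unmarked-slice-⊑ : ∀ (w : List A) a m t → Unmarked a (a + m) → a + m ≤ t →
                       map inj₁ (slice w a m) ⊑ take t (replace pos w)
    unmarked-slice-⊑ w a m t unmarked a+m≤t =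
      subst (_⊑ take t (replace pos w)) (replace-slice-unmarked w a m unmarked) (slice-⊑-take _ a m t a+m≤t)

module _ {A : Set} {P Q : Pred A 0ℓ} (P? : Decidable P) (Q? : Decidable Q) (P⇒Q : ∀ {x} → P x → Q x) where

  filter-length-mono : ∀ xs → length (filter P? xs) ≤ length (filter Q? xs)
  filter-length-mono []       = z≤n
  filter-length-mono (x ∷ xs) with P? x | Q? x
  ... | yes _  | yes _  = s≤s (filter-length-mono xs)
  ... | yes px | no ¬qx = contradiction (P⇒Q px) ¬qx
  ... | no _   | yes _  = m≤n⇒m≤1+n (filter-length-mono xs)
  ... | no _   | no _   = filter-length-mono xs

  filter-length-mono-< : ∀ {y xs} → y ∈ xs → Q y → ¬ P y → length (filter P? xs) < length (filter Q? xs)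
  filter-length-mono-< {xs = x ∷ xs} (here refl) qy ¬py with P? x | Q? x
  ... | yes py | _      = contradiction py ¬py
  ... | no _   | yes _  = s≤s (filter-length-mono xs)
  ... | no _   | no ¬qy = contradiction qy ¬qy
  filter-length-mono-< {xs = x ∷ xs} (there y∈xs) qy ¬py with P? x | Q? x
  ... | yes _  | yes _  = s≤s (filter-length-mono-< y∈xs qy ¬py)
  ... | yes px | no ¬qx = contradiction (P⇒Q px) ¬qx
  ... | no _   | yes _  = m≤n⇒m≤1+n (filter-length-mono-< y∈xs qy ¬py)
  ... | no _   | no _   = filter-length-mono-< y∈xs qy ¬py

module _ (l r : ℕ) where

  countIn-∷-in : ∀ {o} xs → l ≤ o → o ≤ r → countIn l r (o ∷ xs) ≡ suc (countIn l r xs)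
  countIn-∷-in xs l≤o o≤r = cong length (filter-accept (λ x → (l ≤? x) ×-dec (x ≤? r)) (l≤o , o≤r))

  countIn-∷-out : ∀ {o} xs → ¬ (l ≤ o × o ≤ r) → countIn l r (o ∷ xs) ≡ countIn l r xs
  countIn-∷-out xs outside = cong length (filter-reject (λ x → (l ≤? x) ×-dec (x ≤? r)) outside)

  countIn-starts-beyond : ∀ {A : Set} {o} (qs : List (List A)) → r < o → countIn l r (starts o qs) ≡ 0
  countIn-starts-beyond []       _   = refl
  countIn-starts-beyond (q ∷ qs) r<o = trans (countIn-∷-out _ (λ (_ , o≤r) → <⇒≱ r<o o≤r))
                                             (countIn-starts-beyond qs (<-≤-trans r<o (m≤m+n _ _)))

-- The jump map

<⇒≤∸1 : ∀ {m n} → m < n → m ≤ n ∸ 1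
<⇒≤∸1 {n = suc n} (s≤s m≤n) = m≤n

m+[n∸1∸m]<n : ∀ {m n} → m < n → m + (n ∸ 1 ∸ m) < n
m+[n∸1∸m]<n {m} {suc n} (s≤s m≤n) = s≤s (≤-reflexive (m+[n∸m]≡n m≤n))

bracket : ∀ (a : ℕ → ℕ) {x} n → a 0 ≤ x → a n ≤ x ⊎ ∃[ j ] j < n × a j ≤ x × x < a (suc j)
bracket a zero    a0≤x = inj₁ a0≤x
bracket a {x} (suc n) a0≤x with a (suc n) ≤? x
... | yes last≤x = inj₁ last≤x
... | no last≰x with bracket a n a0≤x
...   | inj₁ an≤x                 = inj₂ (n , ≤-refl , an≤x , ≰⇒> last≰x)
...   | inj₂ (j , j<n , between) = inj₂ (j , m<n⇒m<1+n j<n , between)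

module JumpProperties {σ k : ℕ} (w : List (Fin σ)) (pos : Fin k → ℕ)
                      (pos-mono : ∀ a b → a Data.Fin.< b → pos a < pos b) where

  open Jump w pos

  i⁺-suc : ∀ {m} (m<k : m < k) → i⁺ (suc m) ≡ suc (pos (fromℕ< m<k))
  i⁺-suc {m} m<k with m <? k
  ... | yes _   = refl
  ... | no m≮k = contradiction m<k m≮k

  i⁺-pos : ∀ ℓ → i⁺ (suc (toℕ ℓ)) ≡ suc (pos ℓ)
  i⁺-pos ℓ = trans (i⁺-suc (Fin.toℕ<n ℓ)) (cong (λ ℓ' → suc (pos ℓ')) (Fin.fromℕ<-toℕ ℓ (Fin.toℕ<n ℓ)))

  i⁺-mono-< : ∀ {a b} → a < b → b ≤ k → i⁺ a < i⁺ b
  i⁺-mono-< {zero}  {suc b} _         b<k rewrite i⁺-suc b<k = s≤s z≤n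
  i⁺-mono-< {suc a} {suc b} (s≤s a<b) b<k rewrite i⁺-suc b<k | i⁺-suc (<-trans a<b b<k) =
    s≤s (pos-mono _ _ (subst₂ _<_ (sym (Fin.toℕ-fromℕ< _)) (sym (Fin.toℕ-fromℕ< _)) a<b))

  i⁺-mono-≤ : ∀ {a b} → a ≤ b → b ≤ k → i⁺ a ≤ i⁺ b
  i⁺-mono-≤ a≤b b≤k with m≤n⇒m<n∨m≡n a≤b
  ... | inj₁ a<b  = <⇒≤ (i⁺-mono-< a<b b≤k)
  ... | inj₂ refl = ≤-refl

  i⁺-cancel-< : ∀ {a b} → a ≤ k → i⁺ a < i⁺ b → a < b
  i⁺-cancel-< {a} {b} a≤k i⁺a<i⁺b with a <? b
  ... | yes a<b = a<b
  ... | no a≮b  = contradiction (i⁺-mono-≤ (≮⇒≥ a≮b) a≤k) (<⇒≱ i⁺a<i⁺b)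

  pos<i⁺k : ∀ ℓ → pos ℓ < i⁺ k
  pos<i⁺k ℓ = subst (_≤ i⁺ k) (i⁺-pos ℓ) (i⁺-mono-≤ (Fin.toℕ<n ℓ) ≤-refl)

  gap-unmarked : ∀ {a} → a < k → Unmarked pos (i⁺ a) (i⁺ (suc a) ∸ 1)
  gap-unmarked {a} a<k ℓ with suc (toℕ ℓ) ≤? a
  ... | yes ℓ<a = inj₁ (subst (_≤ i⁺ a) (i⁺-pos ℓ) (i⁺-mono-≤ ℓ<a (<⇒≤ a<k)))
  ... | no ℓ≮a  = inj₂ (∸-monoˡ-≤ 1 (subst (i⁺ (suc a) ≤_) (i⁺-pos ℓ) (i⁺-mono-≤ (≰⇒> ℓ≮a) (Fin.toℕ<n ℓ))))

  slice-⊑-seg : ∀ a a' {x m} → i⁺ a ≤ x → x + m < i⁺ a' → slice w x m ⊑ seg a a'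
  slice-⊑-seg a a' {x} {m} i⁺a≤x x+m<i⁺a' = subst (_⊑ seg a a') same (slice-⊑ (seg a a') (x ∸ i⁺ a) m)
    where
    fits : (x ∸ i⁺ a) + m ≤ i⁺ a' ∸ 1 ∸ i⁺ a
    fits = subst (_≤ i⁺ a' ∸ 1 ∸ i⁺ a) (+-∸-comm m i⁺a≤x) (∸-monoˡ-≤ (i⁺ a) (<⇒≤∸1 x+m<i⁺a'))
    same : slice (seg a a') (x ∸ i⁺ a) m ≡ slice w x m
    same = trans (slice-slice w (i⁺ a) (x ∸ i⁺ a) m _ fits) (cong (λ y → slice w y m) (m+[n∸m]≡n i⁺a≤x))

  seg-⊑-seg : ∀ {ℓ ℓ' c' c} → ℓ ≤ ℓ' → ℓ' < c' → c' ≤ c → c ≤ k → seg ℓ' c' ⊑ seg ℓ c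
  seg-⊑-seg {ℓ} {ℓ'} {c'} {c} ℓ≤ℓ' ℓ'<c' c'≤c c≤k =
    slice-⊑-seg ℓ c (i⁺-mono-≤ ℓ≤ℓ' (≤-trans (<⇒≤ ℓ'<c') c'≤k))
                (<-≤-trans (m+[n∸1∸m]<n (i⁺-mono-< ℓ'<c' c'≤k)) (i⁺-mono-≤ c'≤c c≤k))
    where c'≤k = ≤-trans c'≤c c≤k

  Occurs : ℕ → ℕ → ℕ → Set
  Occurs t ℓ c = map inj₁ (seg ℓ c) ⊑ take t w'

  Occurs-⊆ : ∀ {t ℓ ℓ' c' c} → ℓ ≤ ℓ' → ℓ' < c' → c' ≤ c → c ≤ k → Occurs t ℓ c → Occurs t ℓ' c'
  Occurs-⊆ ℓ≤ℓ' ℓ'<c' c'≤c c≤k = ⊑-trans (⊑-map inj₁ (seg-⊑-seg ℓ≤ℓ' ℓ'<c' c'≤c c≤k))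

  Occurs-mono : ∀ {t t' ℓ c} → t ≤ t' → Occurs t ℓ c → Occurs t' ℓ c
  Occurs-mono t≤t' occ = ⊑-trans occ (take-⊑-take w' t≤t')

  best-≥ : ∀ {t ℓ c'} c → ℓ < c' → c' ≤ c → Occurs t ℓ c' → c' ≤ best t ℓ c
  best-≥ zero () z≤n _
  best-≥ {t} {ℓ} (suc c) ℓ<c' c'≤c occ with (ℓ <? suc c) ×-dec occ? t ℓ (suc c)
  ... | yes _ = c'≤c
  ... | no ¬both with m≤n⇒m<n∨m≡n c'≤c
  ...   | inj₁ c'<1+c = best-≥ c ℓ<c' (Data.Nat.s≤s⁻¹ c'<1+c) occ
  ...   | inj₂ refl   = contradiction (ℓ<c' , occ) ¬both

  best-spec : ∀ t ℓ c → best t ℓ c ≡ suc ℓ ⊎ (ℓ < best t ℓ c × best t ℓ c ≤ c × Occurs t ℓ (best t ℓ c))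
  best-spec t ℓ zero = inj₁ refl
  best-spec t ℓ (suc c) with (ℓ <? suc c) ×-dec occ? t ℓ (suc c)
  ... | yes (ℓ<1+c , occ) = inj₂ (ℓ<1+c , ≤-refl , occ)
  ... | no _ with best-spec t ℓ c
  ...   | inj₁ ≡suc               = inj₁ ≡suc
  ...   | inj₂ (ℓ<b , b≤c , occ) = inj₂ (ℓ<b , m≤n⇒m≤1+n b≤c , occ)

  g-top : ∀ t {ℓ} → k ≤ ℓ → g t ℓ ≡ k
  g-top t {ℓ} k≤ℓ with k ≤? ℓ
  ... | yes _   = refl
  ... | no k≰ℓ = contradiction k≤ℓ k≰ℓ

  g-bounds : ∀ t {ℓ} → ℓ < k → ℓ < g t ℓ × g t ℓ ≤ k
  g-bounds t {ℓ} ℓ<k with k ≤? ℓ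
  ... | yes k≤ℓ = contradiction k≤ℓ (<⇒≱ ℓ<k)
  ... | no _ with occ? t ℓ (suc ℓ)
  ...   | no _ = ≤-refl , ℓ<k
  ...   | yes _ with best-spec t ℓ k
  ...     | inj₁ ≡suc              = subst (ℓ <_) (sym ≡suc) ≤-refl , subst (_≤ k) (sym ≡suc) ℓ<k
  ...     | inj₂ (ℓ<b , b≤k , _) = ℓ<b , b≤k

  g-suc-or-occurs : ∀ t {ℓ} → ℓ < k → g t ℓ ≡ suc ℓ ⊎ Occurs t ℓ (g t ℓ)
  g-suc-or-occurs t {ℓ} ℓ<k with k ≤? ℓ
  ... | yes k≤ℓ = contradiction k≤ℓ (<⇒≱ ℓ<k)
  ... | no _ with occ? t ℓ (suc ℓ)
  ...   | no _ = inj₁ refl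
  ...   | yes _ with best-spec t ℓ k
  ...     | inj₁ ≡suc            = inj₁ ≡suc
  ...     | inj₂ (_ , _ , occ) = inj₂ occ

  occurs⇒≤g : ∀ t {ℓ c} → ℓ < c → c ≤ k → Occurs t ℓ c → c ≤ g t ℓ
  occurs⇒≤g t {ℓ} ℓ<c c≤k occ with k ≤? ℓ
  ... | yes k≤ℓ = contradiction (<-≤-trans ℓ<c c≤k) (<⇒≱ (s≤s k≤ℓ))
  ... | no _ with occ? t ℓ (suc ℓ)
  ...   | no ¬occ = contradiction (Occurs-⊆ ≤-refl ≤-refl ℓ<c c≤k occ) ¬occ
  ...   | yes _   = best-≥ k ℓ<c c≤k occ

  g-≤k : ∀ t ℓ → g t ℓ ≤ k
  g-≤k t ℓ with ℓ <? k
  ... | yes ℓ<k = proj₂ (g-bounds t ℓ<k)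
  ... | no ℓ≮k  = ≤-reflexive (g-top t (≮⇒≥ ℓ≮k))

  g-inflationary : ∀ t {ℓ} → ℓ ≤ k → ℓ ≤ g t ℓ
  g-inflationary t ℓ≤k with m≤n⇒m<n∨m≡n ℓ≤k
  ... | inj₁ ℓ<k  = <⇒≤ (proj₁ (g-bounds t ℓ<k))
  ... | inj₂ refl = ≤-reflexive (sym (g-top t ≤-refl))

  g-monoˡ : ∀ {t t'} ℓ → t ≤ t' → g t ℓ ≤ g t' ℓ
  g-monoˡ {t} {t'} ℓ t≤t' with ℓ <? k
  ... | no ℓ≮k  = ≤-reflexive (trans (g-top t (≮⇒≥ ℓ≮k)) (sym (g-top t' (≮⇒≥ ℓ≮k))))
  ... | yes ℓ<k with g-suc-or-occurs t ℓ<k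
  ...   | inj₁ ≡suc = subst (_≤ g t' ℓ) (sym ≡suc) (proj₁ (g-bounds t' ℓ<k))
  ...   | inj₂ occ  = occurs⇒≤g t' (proj₁ (g-bounds t ℓ<k)) (g-≤k t ℓ) (Occurs-mono {ℓ = ℓ} {c = g t ℓ} t≤t' occ)

  g-monoʳ : ∀ t {ℓ ℓ'} → ℓ ≤ ℓ' → g t ℓ ≤ g t ℓ'
  g-monoʳ t {ℓ} {ℓ'} ℓ≤ℓ' with ℓ' <? k | g t ℓ ≤? ℓ'
  ... | no ℓ'≮k | _         = subst (g t ℓ ≤_) (sym (g-top t (≮⇒≥ ℓ'≮k))) (g-≤k t ℓ)
  ... | yes ℓ'<k | yes gℓ≤ℓ' = ≤-trans gℓ≤ℓ' (g-inflationary t (<⇒≤ ℓ'<k))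
  ... | yes ℓ'<k | no gℓ≰ℓ' with g-suc-or-occurs t (≤-<-trans ℓ≤ℓ' ℓ'<k)
  ...   | inj₂ occ  = occurs⇒≤g t (≰⇒> gℓ≰ℓ') (g-≤k t ℓ) (Occurs-⊆ ℓ≤ℓ' (≰⇒> gℓ≰ℓ') ≤-refl (g-≤k t ℓ) occ)
  ...   | inj₁ ≡suc = ≤-reflexive (cong (g t) (≤-antisym ℓ≤ℓ' (Data.Nat.s≤s⁻¹ (subst (ℓ' <_) ≡suc (≰⇒> gℓ≰ℓ')))))

  g-mono : ∀ {t t' ℓ ℓ'} → t ≤ t' → ℓ ≤ ℓ' → g t ℓ ≤ g t' ℓ'
  g-mono {t} {t'} {ℓ' = ℓ'} t≤t' ℓ≤ℓ' = ≤-trans (g-monoʳ t ℓ≤ℓ') (g-monoˡ {t} {t'} ℓ' t≤t')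

  iter-+ : ∀ f e m x → iter f (e + m) x ≡ iter f e (iter f m x)
  iter-+ f zero    m x = refl
  iter-+ f (suc e) m x = cong f (iter-+ f e m x)

  iter-mono : ∀ {f f'} → (∀ {x y} → x ≤ y → f x ≤ f' y) → ∀ s {x y} → x ≤ y → iter f s x ≤ iter f' s y
  iter-mono f≤f' zero    x≤y = x≤y
  iter-mono f≤f' (suc s) x≤y = f≤f' (iter-mono f≤f' s x≤y)

  iter-≤k : ∀ t s {x} → x ≤ k → iter (g t) s x ≤ k
  iter-≤k t zero    x≤k = x≤k
  iter-≤k t (suc s) _   = g-≤k t _

  iter-inflationary : ∀ t s {x} → x ≤ k → x ≤ iter (g t) s x
  iter-inflationary t zero    _   = ≤-refl
  iter-inflationary t (suc s) x≤k = ≤-trans (iter-inflationary t s x≤k) (g-inflationary t (iter-≤k t s x≤k))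

  chain : ℕ → ℕ → ℕ
  chain t s = iter (g t) s 0

  chain-≤k : ∀ t s → chain t s ≤ k
  chain-≤k t s = iter-≤k t s z≤n

  chain-mono : ∀ t {i j} → i ≤ j → chain t i ≤ chain t j
  chain-mono t {i} {j} i≤j = subst (chain t i ≤_) chain-j (iter-inflationary t (j ∸ i) (chain-≤k t i))
    where
    chain-j : iter (g t) (j ∸ i) (chain t i) ≡ chain t j
    chain-j = trans (sym (iter-+ (g t) (j ∸ i) i 0)) (cong (chain t) (m∸n+n≡m i≤j))

  chain-≥ : ∀ t {s} → s ≤ k → s ≤ chain t s
  chain-≥ t {zero}  _   = z≤n
  chain-≥ t {suc s} s<k with chain t s <? k
  ... | yes chain<k = <-≤-trans (s≤s (chain-≥ t (<⇒≤ s<k))) (proj₁ (g-bounds t chain<k))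
  ... | no chain≮k  = ≤-trans s<k (≤-reflexive (sym (g-top t (≮⇒≥ chain≮k))))

  chain-catch-up : ∀ {t t' i m} e → t ≤ t' → chain t i ≤ chain t' m → chain t (e + i) ≤ chain t' (e + m)
  chain-catch-up {t} {t'} {i} {m} e t≤t' reached =
    subst₂ _≤_ (sym (iter-+ (g t) e i 0)) (sym (iter-+ (g t') e m 0)) (iter-mono (g-mono t≤t') e reached)

  module _ {Q : ℕ → Set} (Q? : Decidable Q) where

    leastFrom-spec : ∀ b fuel {s} → b ≤ s → s ≤ b + fuel → Q s →
                     Q (leastFrom (λ x → does (Q? x)) b fuel) × leastFrom (λ x → does (Q? x)) b fuel ≤ s
    leastFrom-spec b zero b≤s s≤b+0 qs with refl ← ≤-antisym b≤s (subst (_ ≤_) (+-identityʳ b) s≤b+0) = qs , ≤-refl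
    leastFrom-spec b (suc fuel) {s} b≤s s≤ qs with Q? b
    ... | yes qb = qb , b≤s
    ... | no ¬qb with m≤n⇒m<n∨m≡n b≤s
    ...   | inj₁ b<s  = leastFrom-spec (suc b) fuel b<s (subst (s ≤_) (+-suc b fuel) s≤) qs
    ...   | inj₂ refl = contradiction qs ¬qb

    leastFrom-least : ∀ b fuel {s} → b ≤ s → s < leastFrom (λ x → does (Q? x)) b fuel → ¬ Q s
    leastFrom-least b zero       b≤s s<b = contradiction s<b (≤⇒≯ b≤s)
    leastFrom-least b (suc fuel) b≤s s< with Q? b
    ... | yes _   = contradiction s< (≤⇒≯ b≤s)
    ... | no ¬qb with m≤n⇒m<n∨m≡n b≤s
    ...   | inj₁ b<s  = leastFrom-least (suc b) fuel b<s s<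
    ...   | inj₂ refl = ¬qb

  depth-spec : ∀ t → k ≤ chain t (depth t) × depth t ≤ k
  depth-spec t = leastFrom-spec (λ s → k ≤? chain t s) 0 k z≤n ≤-refl (chain-≥ t ≤-refl)

  chain-depth : ∀ t → chain t (depth t) ≡ k
  chain-depth t = ≤-antisym (chain-≤k t (depth t)) (proj₁ (depth-spec t))

  depth-minimal : ∀ t {s} → k ≤ chain t s → depth t ≤ s
  depth-minimal t {s} k≤chain with s ≤? k
  ... | yes s≤k = proj₂ (leastFrom-spec (λ s → k ≤? chain t s) 0 k z≤n s≤k k≤chain)
  ... | no s≰k  = ≤-trans (proj₂ (depth-spec t)) (<⇒≤ (≰⇒> s≰k))

  chain<k : ∀ t {j} → j < depth t → chain t j < k
  chain<k t j<depth = ≰⇒> (leastFrom-least (λ s → k ≤? chain t s) 0 k z≤n j<depth)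

-- LZ77 phrases

module _ {A : Set} where

  prefix-occurs : ∀ {pre p rest : List A} → Phrase pre p rest → ∀ m → m < length p → take m p ⊑ pre
  prefix-occurs _  zero    _     = here Prefix.[]
  prefix-occurs ph (suc m) m<len = Phrase.shorterOccur ph (suc m) (s≤s z≤n) m<len

  phrase-novel : ∀ {pre p rest : List A} → Phrase pre p rest →
                 ¬ (slice (pre ++ p ++ rest) (length pre) (length p) ⊑ take (length pre) (pre ++ p ++ rest))
                 ⊎ rest ≡ []
  phrase-novel {pre} {p} {rest} ph =
    Data.Sum.map₁ (λ new old → new (subst₂ _⊑_ (slice-++ pre p rest) (take-length-++ pre _) old)) (Phrase.newOrLast ph)

  lz77-span : ∀ {pre v : List A} {ps} → LZ77From pre v ps → ∀ {o l r} → length pre ≡ o → (l , r) ∈ spans o ps →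
              ∃[ pre' ] ∃[ x ] ∃[ rest ] Phrase pre' x rest × pre ++ v ≡ pre' ++ x ++ rest ×
                                         length pre' ≡ l × r ≡ l + length x ∸ 1
  lz77-span done                      _    ()
  lz77-span {pre} (step {p} {rest} ph next) refl (here refl) = pre , p , rest , ph , refl , refl , refl
  lz77-span {pre} (step {p} {rest} ph next) refl (there span)
    with pre' , x , rest' , ph' , split , ≡l , ≡r ← lz77-span next (length-++ pre) span =
    pre' , x , rest' , ph' , trans (sym (++-assoc pre p rest)) split , ≡l , ≡r

  record EarlierOccurrence (w : List A) (l L : ℕ) : Set where
    field
      source     : ℕ
      source+L≤l : source + L ≤ l
      same       : slice w source L ≡ slice w l L

  phrase-repeats : ∀ {pre x rest : List A} → Phrase pre x rest →
                   ∃[ L ] length x ≡ suc L × EarlierOccurrence (pre ++ x ++ rest) (length pre) L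
  phrase-repeats {x = []} ph = contradiction (Phrase.nonEmpty ph) λ ()
  phrase-repeats {pre} {a ∷ ys} {rest} ph =
    L , refl , record { source = j ; source+L≤l = j+L≤l ; same = same }
    where
    w : List A
    w = pre ++ (a ∷ ys) ++ rest
    l L j : ℕ
    l = length pre
    L = length ys
    |take| : length (take L (a ∷ ys)) ≡ L
    |take| = trans (length-take L (a ∷ ys)) (m≤n⇒m⊓n≡m (n≤1+n L))
    occurrence : ∃[ j ] j + length (take L (a ∷ ys)) ≤ l × slice pre j (length (take L (a ∷ ys))) ≡ take L (a ∷ ys)
    occurrence = ⊑⇒slice (prefix-occurs ph L ≤-refl)
    j = proj₁ occurrence
    j+L≤l : j + L ≤ l
    j+L≤l = subst (λ m → j + m ≤ l) |take| (proj₁ (proj₂ occurrence))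
    same : slice w j L ≡ slice w l L
    same = begin
      slice w j L                    ≡⟨ slice-slice w 0 j L l j+L≤l ⟨
      slice (take l w) j L           ≡⟨ cong (λ v → slice v j L) (take-length-++ pre _) ⟩
      slice pre j L                  ≡⟨ subst (λ m → slice pre j m ≡ take L (a ∷ ys)) |take| (proj₂ (proj₂ occurrence)) ⟩
      take L (a ∷ ys)                ≡⟨ cong (λ v → slice v 0 L) (slice-++ pre (a ∷ ys) rest) ⟨
      slice (slice w l (suc L)) 0 L  ≡⟨ slice-slice w l 0 L (suc L) (n≤1+n L) ⟩
      slice w (l + 0) L              ≡⟨ cong (λ i → slice w i L) (+-identityʳ l) ⟩
      slice w l L                    ∎
      where open ≡-Reasoning

  lz77-phrase-repeats : ∀ {w : List A} {ps} → IsLZ77 w ps → ∀ {l r} → (l , r) ∈ spans 0 ps →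
                        ∃[ L ] r ≡ l + L × l + L < length w × EarlierOccurrence w l L
  lz77-phrase-repeats {w} lz {l} {r} span = repeats (lz77-span lz refl span)
    where
    repeats : ∃[ pre ] ∃[ x ] ∃[ rest ] Phrase pre x rest × w ≡ pre ++ x ++ rest ×
                                        length pre ≡ l × r ≡ l + length x ∸ 1 →
              ∃[ L ] r ≡ l + L × l + L < length w × EarlierOccurrence w l L
    repeats (pre , x , rest , ph , split , ≡l , ≡r) with L , |x| , occ ← phrase-repeats ph =
      L , r≡ , before-end , subst₂ (λ v i → EarlierOccurrence v i L) (sym split) ≡l occ
      where
      r≡ : r ≡ l + L
      r≡ = trans ≡r (trans (cong (λ m → l + m ∸ 1) |x|) (cong (_∸ 1) (+-suc l L)))
      before-end : l + L < length w
      before-end = begin-strict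
        l + L                                  <⟨ +-monoʳ-< l (s≤s (m≤m+n L (length rest))) ⟩
        l + (suc L + length rest)              ≡⟨ cong₂ (λ i m → i + (m + length rest)) (sym ≡l) (sym |x|) ⟩
        length pre + (length x + length rest)  ≡⟨ cong (length pre +_) (length-++ x) ⟨
        length pre + length (x ++ rest)        ≡⟨ length-++ pre ⟨
        length (pre ++ x ++ rest)              ≡⟨ cong length split ⟨
        length w                               ∎
        where open ≤-Reasoning

-- Phrases of w' inside a phrase of w

module _ where
  open ≤-Reasoning
  open import Data.Nat.Tactic.RingSolver using (solve)

  budget-close : ∀ c m x → c + m ≤ x + 1 → c + suc m ≤ x + 2
  budget-close c m x within = begin
    c + suc m    ≡⟨ +-suc c m ⟩
    suc (c + m)  ≤⟨ s≤s within ⟩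
    suc (x + 1)  ≡⟨ solve (x ∷ []) ⟩
    x + 2        ∎

  budget-mark : ∀ c m h h' i → c + m ≤ 3 * h + i + 2 → suc h ≤ h' → suc c + m ≤ 3 * h' + i + 0
  budget-mark c m h h' i within more = begin
    suc (c + m)           ≤⟨ s≤s within ⟩
    suc (3 * h + i + 2)   ≡⟨ solve (h ∷ i ∷ []) ⟩
    3 * suc h + i + 0     ≤⟨ +-monoˡ-≤ 0 (+-monoˡ-≤ i (*-monoʳ-≤ 3 more)) ⟩
    3 * h' + i + 0        ∎

  budget-open : ∀ c m h h' i d → c + m ≤ 3 * h + i + 0 → h ≤ h' → suc c + (d + m) ≤ 3 * h' + (i + d) + 1
  budget-open c m h h' i d within more = begin
    suc c + (d + m)          ≡⟨ solve (c ∷ d ∷ m ∷ []) ⟩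
    (c + m) + suc d          ≤⟨ +-monoˡ-≤ (suc d) within ⟩
    (3 * h + i + 0) + suc d  ≡⟨ solve (h ∷ i ∷ d ∷ []) ⟩
    3 * h + (i + d) + 1      ≤⟨ +-monoˡ-≤ 1 (+-monoˡ-≤ (i + d) (*-monoʳ-≤ 3 more)) ⟩
    3 * h' + (i + d) + 1     ∎

  budget-extend : ∀ c m h h' v j → c + m ≤ 3 * h + v + 1 → h ≤ h' → v < j → suc c + m ≤ 3 * h' + j + 1
  budget-extend c m h h' v j within more v<j = begin
    suc (c + m)           ≤⟨ s≤s within ⟩
    suc (3 * h + v + 1)   ≡⟨ solve (h ∷ v ∷ []) ⟩
    3 * h + suc v + 1     ≤⟨ +-monoˡ-≤ 1 (+-mono-≤ (*-monoʳ-≤ 3 more) v<j) ⟩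
    3 * h' + j + 1        ∎

  budget-finish : ∀ c m h n i d → c + m ≤ 3 * h + i + 2 → h ≤ n → suc c + (d + m) ≤ 3 + (i + d) + 3 * n
  budget-finish c m h n i d within h≤n = begin
    suc c + (d + m)          ≡⟨ solve (c ∷ d ∷ m ∷ []) ⟩
    (c + m) + suc d          ≤⟨ +-monoˡ-≤ (suc d) within ⟩
    (3 * h + i + 2) + suc d  ≡⟨ solve (h ∷ i ∷ d ∷ []) ⟩
    3 + (i + d) + 3 * h      ≤⟨ +-monoʳ-≤ (3 + (i + d)) (*-monoʳ-≤ 3 h≤n) ⟩
    3 + (i + d) + 3 * n      ∎

module PhraseCount {σ k : ℕ} (w : List (Fin σ)) (pos : Fin k → ℕ)
                   (pos-mono : ∀ a b → a Data.Fin.< b → pos a < pos b)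
                   (l L : ℕ) (earlier : EarlierOccurrence w l L) (r<n : l + L < length w) where

  open Jump w pos
  open JumpProperties w pos pos-mono
  open EarlierOccurrence earlier renaming (source to s)

  r δ D : ℕ
  r = l + L
  δ = l ∸ s
  D = depth l

  s+δ≡l : s + δ ≡ l
  s+δ≡l = m+[n∸m]≡n (≤-trans (m≤m+n s L) source+L≤l)

  r≡s+L+δ : r ≡ s + L + δ
  r≡s+L+δ = begin
    l + L        ≡⟨ cong (_+ L) s+δ≡l ⟨
    s + δ + L    ≡⟨ +-right-comm s δ L ⟩
    s + L + δ    ∎
    where open ≡-Reasoning

  unshift : ∀ {a b} → a + δ ≤ b + δ → a ≤ b
  unshift {a} {b} = +-cancelʳ-≤ δ a b

  copy-shift : ∀ {y M} → s ≤ y → y + M ≤ s + L → slice w (y + δ) M ≡ slice w y M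
  copy-shift {y} {M} s≤y y+M≤s+L = begin
    slice w (y + δ) M             ≡⟨ cong (λ i → slice w i M) shifted ⟩
    slice w (l + d) M             ≡⟨ slice-slice w l d M L d+M≤L ⟨
    slice (slice w l L) d M       ≡⟨ cong (λ v → slice v d M) same ⟨
    slice (slice w s L) d M       ≡⟨ slice-slice w s d M L d+M≤L ⟩
    slice w (s + d) M             ≡⟨ cong (λ i → slice w i M) (m+[n∸m]≡n s≤y) ⟩
    slice w y M                   ∎
    where
    open ≡-Reasoning
    d : ℕ
    d = y ∸ s
    shifted : y + δ ≡ l + d
    shifted = begin
      y + δ          ≡⟨ cong (_+ δ) (m+[n∸m]≡n s≤y) ⟨
      s + d + δ      ≡⟨ +-right-comm s d δ ⟩
      s + δ + d      ≡⟨ cong (_+ d) s+δ≡l ⟩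
      l + d          ∎
    d+M≤L : d + M ≤ L
    d+M≤L = +-cancelˡ-≤ s (d + M) L (subst (_≤ s + L) y+M≡s+[d+M] y+M≤s+L)
      where
      y+M≡s+[d+M] : y + M ≡ s + (d + M)
      y+M≡s+[d+M] = trans (cong (_+ M) (sym (m+[n∸m]≡n s≤y))) (+-assoc s d M)

  -- node⁺ j - 1 is the j-th chain point of g_l moved by δ into the phrase.
  node⁺ : ℕ → ℕ
  node⁺ j = i⁺ (chain l j) + δ

  node-order : ∀ {i j o} → node⁺ i ≤ o → o < node⁺ j → i < j
  node-order {i} {j} i≤o o<j with i <? j
  ... | yes i<j = i<j
  ... | no i≮j  = contradiction (chain-mono l (≮⇒≥ i≮j))
                    (<⇒≱ (i⁺-cancel-< (chain-≤k l i) (+-cancelʳ-< δ _ _ (≤-<-trans i≤o o<j))))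

  plain-occurs : ∀ {x m t} → Unmarked pos x (x + m) → x + m ≤ t → map inj₁ (slice w x m) ⊑ take t w'
  plain-occurs {x} {m} {t} = unmarked-slice-⊑ pos w x m t

  -- The chain points of g_l cut w[0 .. l - 1] into blocks that occur in w'[0 .. l - 1] or
  -- contain no substituted position; a window that avoids every chain point lies in one block.
  window-hits-node-or-occurs : ∀ x m → x + m ≤ l →
    (∃[ j ] j ≤ D × x < i⁺ (chain l j) × i⁺ (chain l j) ≤ x + m) ⊎ map inj₁ (slice w x m) ⊑ take l w'
  window-hits-node-or-occurs x m x+m≤l with bracket (λ j → i⁺ (chain l j)) D z≤n
  ... | inj₁ last≤x = inj₂ (plain-occurs after-all x+m≤l)
    where
    after-all : Unmarked pos x (x + m)
    after-all ℓ = inj₁ (<-≤-trans (pos<i⁺k ℓ) (subst (λ c → i⁺ c ≤ x) (chain-depth l) last≤x))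
  ... | inj₂ (j , j<D , start≤x , x<end) with i⁺ (chain l (suc j)) ≤? x + m
  ...   | yes end≤x+m = inj₁ (suc j , j<D , x<end , end≤x+m)
  ...   | no end≰x+m with g-suc-or-occurs l (chain<k l j<D)
  ...     | inj₂ occ   = inj₂ (⊑-trans (⊑-map inj₁ (slice-⊑-seg (chain l j) (chain l (suc j)) start≤x (≰⇒> end≰x+m))) occ)
  ...     | inj₁ ≡suc  = inj₂ (plain-occurs (Unmarked-⊆ pos start≤x x+m≤gap (gap-unmarked (chain<k l j<D))) x+m≤l)
    where
    x+m≤gap : x + m ≤ i⁺ (suc (chain l j)) ∸ 1
    x+m≤gap = <⇒≤∸1 (subst (λ c → x + m < i⁺ c) ≡suc (≰⇒> end≰x+m))

  -- The block of w between the chain points u and v reappears, moved by δ, inside the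
  -- unsubstituted stretch [node⁺ u, o) of w', hence inside w'[0 .. r - 1].
  shortcut : ∀ {u v o} → u ≤ v → v ≤ D → l ≤ node⁺ u → Unmarked pos (node⁺ u) o → node⁺ v ≤ o → o ≤ r →
             chain l v ≤ g r (chain l u)
  shortcut {u} {v} {o} u≤v v≤D l≤u unmarked v≤o o≤r with m≤n⇒m<n∨m≡n (chain-mono l u≤v)
  ... | inj₂ same-node = subst (_≤ g r (chain l u)) same-node (g-inflationary r (chain-≤k l u))
  ... | inj₁ u<v = occurs⇒≤g r u<v (chain-≤k l v) occurs
    where
    y M : ℕ
    y = i⁺ (chain l u)
    M = i⁺ (chain l v) ∸ 1 ∸ y
    y+M<v : y + M < i⁺ (chain l v)
    y+M<v = m+[n∸1∸m]<n (i⁺-mono-< u<v (chain-≤k l v))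
    shifted-end : y + δ + M < node⁺ v
    shifted-end = subst (_< node⁺ v) (+-right-comm y M δ) (+-monoˡ-< δ y+M<v)
    s≤y : s ≤ y
    s≤y = unshift (subst (_≤ y + δ) (sym s+δ≡l) l≤u)
    shifted-end≤r : y + δ + M ≤ r
    shifted-end≤r = <⇒≤ (<-≤-trans shifted-end (≤-trans v≤o o≤r))
    y+M≤s+L : y + M ≤ s + L
    y+M≤s+L = unshift (subst₂ _≤_ (+-right-comm y δ M) r≡s+L+δ shifted-end≤r)
    occurs : Occurs r (chain l u) (chain l v)
    occurs = subst (λ z → map inj₁ z ⊑ take r w') (copy-shift s≤y y+M≤s+L)
                   (plain-occurs (Unmarked-⊆ pos ≤-refl (<⇒≤ (<-≤-trans shifted-end v≤o)) unmarked) shifted-end≤r)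

  marks : ℕ → ℕ
  marks o = length (filter (λ x → (l ≤? x) ×-dec (x <? o)) (tabulate pos))

  nj : ℕ
  nj = countIn l r (tabulate pos)

  marks-mono : ∀ {o o'} → o ≤ o' → marks o ≤ marks o'
  marks-mono o≤o' = filter-length-mono _ _ (λ (l≤x , x<o) → l≤x , <-≤-trans x<o o≤o') (tabulate pos)

  marks-mono-< : ∀ {o o' ℓ} → l ≤ o → o ≤ pos ℓ → pos ℓ < o' → marks o < marks o'
  marks-mono-< {o} {o'} {ℓ} l≤o o≤p p<o' =
    filter-length-mono-< _ _ (λ (l≤x , x<o) → l≤x , <-trans x<o (≤-<-trans o≤p p<o')) (∈-tabulate⁺ ℓ)
                         (≤-trans l≤o o≤p , p<o') (λ (_ , p<o) → <⇒≱ p<o o≤p)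

  marks≤nj : ∀ {o} → o ≤ suc r → marks o ≤ nj
  marks≤nj o≤1+r = filter-length-mono _ _ (λ (l≤x , x<o) → l≤x , Data.Nat.s≤s⁻¹ (<-≤-trans x<o o≤1+r)) (tabulate pos)

  -- Invariants after the c phrases of w' starting in [l, o): in m steps g_r reaches the i-th
  -- chain point of g_l (Closed, with slack e), or the u-th one while a run of unsubstituted
  -- phrases has passed the moved chain points up to v (Open); one more g_r step then reaches v.
  record Closed (e o c : ℕ) : Set where
    field
      i m     : ℕ
      i≤D     : i ≤ D
      reached : chain l i ≤ chain r m
      node≤o  : node⁺ i ≤ o
      budget  : c + m ≤ 3 * marks o + i + e

  record Open (o c : ℕ) : Set where
    field
      u v m    : ℕ
      u≤v      : u ≤ v
      v≤D      : v ≤ D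
      reached  : chain l u ≤ chain r m
      l≤node   : l ≤ node⁺ u
      unmarked : Unmarked pos (node⁺ u) o
      node≤o   : node⁺ v ≤ o
      budget   : c + m ≤ 3 * marks o + v + 1

  Bounded : ℕ → Set
  Bounded c = ∃[ M ] k ≤ chain r M × c + M ≤ 3 + D + 3 * nj

  Bounded-weaken : ∀ {c c'} → c ≤ c' → Bounded c' → Bounded c
  Bounded-weaken c≤c' (M , reached , within) = M , reached , ≤-trans (+-monoˡ-≤ M c≤c') within

  closed-at : ∀ {o} → l ≤ o → Closed 0 o 0
  closed-at l≤o = record
    { i = 0 ; m = 0 ; i≤D = z≤n ; reached = z≤n ; node≤o = ≤-trans (m∸n≤m l s) l≤o ; budget = z≤n }

  settle : ∀ {o c} → o ≤ r → Closed 0 o c ⊎ Open o c → Closed 2 o c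
  settle _   (inj₁ closed) = record
    { i = i ; m = m ; i≤D = i≤D ; reached = reached ; node≤o = node≤o
    ; budget = ≤-trans budget (+-monoʳ-≤ _ z≤n) }
    where open Closed closed
  settle o≤r (inj₂ open′) = record
    { i = v ; m = suc m ; i≤D = v≤D
    ; reached = ≤-trans (shortcut u≤v v≤D l≤node unmarked node≤o o≤r) (g-monoʳ r reached)
    ; node≤o = node≤o ; budget = budget-close _ m _ budget }
    where open Open open′

  after-mark : ∀ {o o' c ℓ} → l ≤ o → o ≤ o' → o ≤ pos ℓ → pos ℓ < o' → Closed 2 o c → Closed 0 o' (suc c)
  after-mark l≤o o≤o' o≤p p<o' closed = record
    { i = i ; m = m ; i≤D = i≤D ; reached = reached
    ; node≤o = ≤-trans node≤o o≤o'
    ; budget = budget-mark _ m _ _ i budget (marks-mono-< l≤o o≤p p<o') }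
    where open Closed closed

  open-at-node : ∀ {o o' c j} → l ≤ o → o ≤ o' → Unmarked pos o o' → j ≤ D → o < node⁺ j → node⁺ j ≤ o' →
                 Closed 0 o c → Open o' (suc c)
  open-at-node {o' = o'} {c} {j} l≤o o≤o' unmarked′ j≤D o<j j≤o' closed = record
    { u = j ; v = j ; m = (j ∸ i) + m ; u≤v = ≤-refl ; v≤D = j≤D
    ; reached = subst (λ n → chain l n ≤ chain r ((j ∸ i) + m)) (m∸n+n≡m i≤j)
                      (chain-catch-up {i = i} {m} (j ∸ i) (m≤m+n l L) reached)
    ; l≤node = ≤-trans l≤o (<⇒≤ o<j)
    ; unmarked = Unmarked-⊆ pos (<⇒≤ o<j) ≤-refl unmarked′
    ; node≤o = j≤o'
    ; budget = subst (λ n → suc c + ((j ∸ i) + m) ≤ 3 * marks o' + n + 1) (m+[n∸m]≡n i≤j)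
                     (budget-open c m _ _ i (j ∸ i) budget (marks-mono o≤o')) }
    where
    open Closed closed
    i≤j : i ≤ j
    i≤j = <⇒≤ (node-order node≤o o<j)

  extend-run : ∀ {o o' c j} → o ≤ o' → Unmarked pos o o' → j ≤ D → o < node⁺ j → node⁺ j ≤ o' →
               Open o c → Open o' (suc c)
  extend-run {j = j} o≤o' unmarked′ j≤D o<j j≤o' open′ = record
    { u = u ; v = j ; m = m ; u≤v = ≤-trans u≤v (<⇒≤ v<j) ; v≤D = j≤D
    ; reached = reached ; l≤node = l≤node
    ; unmarked = Unmarked-join pos unmarked unmarked′
    ; node≤o = j≤o'
    ; budget = budget-extend _ m _ _ v _ budget (marks-mono o≤o') v<j }
    where
    open Open open′
    v<j : v < j
    v<j = node-order node≤o o<j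

  finish : ∀ {o c} → o ≤ r → Closed 2 o c → Bounded (suc c)
  finish {c = c} o≤r closed =
    (D ∸ i) + m , k≤chain , subst (λ n → suc c + ((D ∸ i) + m) ≤ 3 + n + 3 * nj) (m+[n∸m]≡n i≤D)
                                   (budget-finish c m _ _ i (D ∸ i) budget (marks≤nj (m≤n⇒m≤1+n o≤r)))
    where
    open Closed closed
    k≤chain : k ≤ chain r ((D ∸ i) + m)
    k≤chain = begin
      k                        ≡⟨ chain-depth l ⟨
      chain l D                ≡⟨ cong (chain l) (m∸n+n≡m i≤D) ⟨
      chain l ((D ∸ i) + i)    ≤⟨ chain-catch-up {i = i} {m} (D ∸ i) (m≤m+n l L) reached ⟩
      chain r ((D ∸ i) + m)    ∎
      where open ≤-Reasoning

  bounded-zero : Bounded 0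
  bounded-zero = D , subst (_≤ chain r D) (chain-depth l) (iter-mono (g-mono (m≤m+n l L)) D z≤n)
                  , ≤-trans (m≤n+m D 3) (m≤m+n (3 + D) _)

  novel-phrase-kind : ∀ {o m} → l ≤ o → o + m ≤ r → ¬ (slice w' o m ⊑ take o w') →
    (∃[ ℓ ] o ≤ pos ℓ × pos ℓ < o + m) ⊎
    (Unmarked pos o (o + m) × ∃[ j ] j ≤ D × o < node⁺ j × node⁺ j ≤ o + m)
  novel-phrase-kind {o} {m} l≤o o+m≤r novel =
    Data.Sum.map₂ (λ unmarked → unmarked , node-inside unmarked) (Data.Sum.swap (unmarked-or-marked pos o (o + m)))
    where
    y : ℕ
    y = o ∸ δ
    y+δ≡o : y + δ ≡ o
    y+δ≡o = m∸n+n≡m (≤-trans (m∸n≤m l s) l≤o)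
    y+m+δ≡o+m : y + m + δ ≡ o + m
    y+m+δ≡o+m = trans (+-right-comm y m δ) (cong (_+ m) y+δ≡o)
    s≤y : s ≤ y
    s≤y = unshift (subst₂ _≤_ (sym s+δ≡l) (sym y+δ≡o) l≤o)
    y+m≤s+L : y + m ≤ s + L
    y+m≤s+L = unshift (subst₂ _≤_ (sym y+m+δ≡o+m) r≡s+L+δ o+m≤r)
    y+m≤l : y + m ≤ l
    y+m≤l = ≤-trans y+m≤s+L source+L≤l
    source-copy : Unmarked pos o (o + m) → slice w' o m ≡ map inj₁ (slice w y m)
    source-copy unmarked = begin
      slice w' o m                  ≡⟨ replace-slice-unmarked pos w o m unmarked ⟩
      map inj₁ (slice w o m)        ≡⟨ cong (λ i → map inj₁ (slice w i m)) y+δ≡o ⟨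
      map inj₁ (slice w (y + δ) m)  ≡⟨ cong (map inj₁) (copy-shift s≤y y+m≤s+L) ⟩
      map inj₁ (slice w y m)        ∎
      where open ≡-Reasoning
    node-inside : Unmarked pos o (o + m) → ∃[ j ] j ≤ D × o < node⁺ j × node⁺ j ≤ o + m
    node-inside unmarked with window-hits-node-or-occurs y m y+m≤l
    ... | inj₁ (j , j≤D , y<j , j≤y+m) =
      j , j≤D , subst (_< node⁺ j) y+δ≡o (+-monoˡ-< δ y<j) , subst (node⁺ j ≤_) y+m+δ≡o+m (+-monoˡ-≤ δ j≤y+m)
    ... | inj₂ occurs =
      contradiction (⊑-trans (subst (_⊑ take l w') (sym (source-copy unmarked)) occurs) (take-⊑-take w' l≤o)) novel

  State : ℕ → ℕ → Set
  State o c = (o < l × c ≡ 0) ⊎ (l ≤ o × o ≤ r × (Closed 0 o c ⊎ Open o c))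

  initial-state : ∀ o → State o 0 ⊎ r < o
  initial-state o with o <? l | o ≤? r
  ... | yes o<l | _       = inj₁ (inj₁ (o<l , refl))
  ... | no o≮l  | yes o≤r = inj₁ (inj₂ (≮⇒≥ o≮l , o≤r , inj₁ (closed-at (≮⇒≥ o≮l))))
  ... | no _    | no o≰r  = inj₂ (≰⇒> o≰r)

  advance : ∀ {o m c} → l ≤ o → o + m ≤ r → ¬ (slice w' o m ⊑ take o w') →
            Closed 0 o c ⊎ Open o c → Closed 0 (o + m) (suc c) ⊎ Open (o + m) (suc c)
  advance {o} {m} l≤o o+m≤r novel state with novel-phrase-kind l≤o o+m≤r novel | state
  ... | inj₁ (ℓ , o≤p , p<o+m) | _ =
    inj₁ (after-mark l≤o (m≤m+n o m) o≤p p<o+m (settle (≤-trans (m≤m+n o m) o+m≤r) state))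
  ... | inj₂ (unmarked , j , j≤D , o<j , j≤o+m) | inj₁ closed =
    inj₂ (open-at-node l≤o (m≤m+n o m) unmarked j≤D o<j j≤o+m closed)
  ... | inj₂ (unmarked , j , j≤D , o<j , j≤o+m) | inj₂ open′ =
    inj₂ (extend-run (m≤m+n o m) unmarked j≤D o<j j≤o+m open′)

  phrase-novel-at : ∀ {pre p rest o} → Phrase pre p rest → length pre ≡ o → pre ++ p ++ rest ≡ w' →
                    o + length p ≤ r → ¬ (slice w' o (length p) ⊑ take o w')
  phrase-novel-at {pre} {p} {rest} ph refl split end≤r with phrase-novel ph
  ... | inj₁ new  = subst (λ v → ¬ (slice v (length pre) (length p) ⊑ take (length pre) v)) split new
  ... | inj₂ refl = contradiction (≤-<-trans end≤r r<n) (≤⇒≯ (≤-reflexive (sym ends)))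
    where
    ends : length pre + length p ≡ length w
    ends = begin
      length pre + length p         ≡⟨ cong (λ n → length pre + length n) (++-identityʳ p) ⟨
      length pre + length (p ++ [])  ≡⟨ length-++ pre ⟨
      length (pre ++ p ++ [])        ≡⟨ cong length split ⟩
      length w'                      ≡⟨ length-substFrom pos 0 w ⟩
      length w                       ∎
      where open ≡-Reasoning

  phrase-step : ∀ {pre p rest o c} → Phrase pre p rest → length pre ≡ o → pre ++ p ++ rest ≡ w' → State o c →
                ∃[ c' ] (∀ xs → c' + countIn l r xs ≡ c + countIn l r (o ∷ xs)) ×
                        (State (o + length p) c' ⊎ (r < o + length p × Bounded c'))
  phrase-step {o = o} _ _ _ (inj₁ (o<l , refl)) =
    0 , (λ xs → sym (countIn-∷-out l r xs (λ (l≤o , _) → <⇒≱ o<l l≤o))) ,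
    Data.Sum.map₂ (_, bounded-zero) (initial-state _)
  phrase-step {p = p} {o = o} {c} ph |pre| split (inj₂ (l≤o , o≤r , state)) = suc c , counted , next
    where
    counted : ∀ xs → suc c + countIn l r xs ≡ c + countIn l r (o ∷ xs)
    counted xs = trans (sym (+-suc c _)) (cong (c +_) (sym (countIn-∷-in l r xs l≤o o≤r)))
    next : State (o + length p) (suc c) ⊎ (r < o + length p × Bounded (suc c))
    next with o + length p ≤? r
    ... | yes end≤r = inj₁ (inj₂ (≤-trans l≤o (m≤m+n o _) , end≤r ,
                                  advance l≤o end≤r (phrase-novel-at ph |pre| split end≤r) state))
    ... | no end≰r  = inj₂ (≰⇒> end≰r , finish o≤r (settle o≤r state))

  scan : ∀ {pre v qs} o → length pre ≡ o → pre ++ v ≡ w' → LZ77From pre v qs →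
         ∀ c → State o c → Bounded (c + countIn l r (starts o qs))
  scan o _ _ done c (inj₁ (_ , refl))        = bounded-zero
  scan o _ _ done c (inj₂ (_ , o≤r , state)) =
    Bounded-weaken (≤-trans (≤-reflexive (+-identityʳ c)) (n≤1+n c)) (finish o≤r (settle o≤r state))
  scan {pre} o |pre| split (step {p} {rest} {ps} ph next) c state
    with phrase-step ph |pre| split state
  ... | c' , counted , inj₁ state' = subst Bounded (counted _)
    (scan (o + length p) (trans (length-++ pre) (cong (_+ length p) |pre|)) (trans (++-assoc pre p rest) split) next c' state')
  ... | c' , counted , inj₂ (r<o' , bounded) = subst Bounded (counted _)
    (subst (λ n → Bounded (c' + n)) (sym (countIn-starts-beyond l r ps r<o')) (Bounded-weaken (≤-reflexive (+-identityʳ c')) bounded))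

  bound : ∀ {qs} → IsLZ77 w' qs → countIn l r (starts 0 qs) + depth r ≤ 3 + D + 3 * nj
  bound lz with initial-state 0
  ... | inj₂ ()
  ... | inj₁ state with M , k≤chain , within ← scan 0 refl refl lz 0 state =
    ≤-trans (+-monoʳ-≤ _ (depth-minimal r k≤chain)) within

proposition3 : ∀ {σ n k : ℕ} (w : List (Fin σ)) → length w ≡ n → 1 ≤ k →
    (pos : Fin k → ℕ) → (∀ a b → a Data.Fin.< b → pos a < pos b) → (∀ a → pos a < n) →
    (ps : List (List (Fin σ))) → IsLZ77 w ps →
    (l r : ℕ) → (l , r) ∈ spans 0 ps →
    (qs : List (List (Fin σ Data.Sum.⊎ Fin k))) → IsLZ77 (replace pos w) qs →
    countIn l r (starts 0 qs) + Jump.depth w pos r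
      ≤ 3 + Jump.depth w pos l + 3 * countIn l r (tabulate pos)
proposition3 w _ _ pos pos-mono _ ps lz l r span qs lz′
  with L , refl , r<n , earlier ← lz77-phrase-repeats lz span =
  PhraseCount.bound w pos pos-mono l L earlier r<n lz′
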